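{- Let $p$ be a prime number and for $n\ge1$ let $c_n=c_n(p)=\sum_{\zeta^p=1}(\zeta-1)^n=p\sum_{0\le r\le n/p}(-1)^{n-pr}\binom{n}{pr}\in\mathbb{Z}$, where $\zeta$ runs over the $p$-th roots of unity in an algebraic closure of $\mathbb{Q}$. Then for all $n\ge 1$, $|c_n|_p\le p^{ -\lceil n/(p-1)\rceil}$, and the rational number $c_n/(pn)$ is $p$-integral.
   Context: $|\cdot|_p$ is the $p$-adic absolute value normalized by $|p|_p=p^{ -1}$, and $\lceil x\rceil=\min\{l\in\mathbb{Z}:x\le l\}$. -}

module Defs where

open import Data.Nat as ℕ using (ℕ; zero; suc; _≤ᵇ_; _∸_; ≢-nonZero)
open import Data.Nat.Combinatorics using (_C_)
open import Data.Integer as ℤ using (ℤ; +_; -_)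
open import Data.List using (List; foldr; map; upTo)
open import Data.Bool using (if_then_else_)
open import Data.Rational as ℚ using (ℚ)
open import Relation.Binary.PropositionalEquality using (_≢_)

sumℤ : List ℤ → ℤ
sumℤ = foldr ℤ._+_ (+ 0)

c : (p n : ℕ) → ℤ
c p n = + p ℤ.* sumℤ (map term (upTo (suc n)))
  where
  term : ℕ → ℤ
  term r = if (p ℕ.* r) ≤ᵇ n
             then ((- (+ 1)) ℤ.^ (n ∸ p ℕ.* r)) ℤ.* (+ (n C (p ℕ.* r)))
             else + 0

-- ceiling division ⌈ n / d ⌉ for d ≥ 1 (d = 0 is never used)
ceilDiv : ℕ → ℕ → ℕ
ceilDiv n zero    = 0
ceilDiv n (suc e) = (n ℕ.+ e) ℕ./ suc e

divℚ : ℤ → (d : ℕ) → d ≢ 0 → ℚ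
divℚ a d h = ℚ._/_ a d {{≢-nonZero h}}

{-# OPTIONS --safe #-}
-- Write c n = p · a n, where a n sums the coefficients of (X - 1)ⁿ at exponents divisible by p
-- (so a n = p⁻¹ ∑_ζ (ζ - 1)ⁿ). Multiplying by Xᵖ = ((X - 1) + 1)ᵖ shifts exponents by p, so
-- ∑_{j ≤ p} C(p,j) a (N + j) = a N, i.e. c (N + p) = - ∑_{0 < j < p} C(p,j) c (N + j), the
-- coordinate form of ζᵖ = 1. Since p divides these C(p,j) and c n = p · a n, induction on n gains
-- a factor p every p - 1 steps: p^⌈n/(p-1)⌉ ∣ c n. If p divided the reduced denominator of
-- c n / (p n), every power of p would divide g = gcd(c n, p n), since p^j ∣ p n forces
-- 1 + (j - 1)(p - 1) ≤ p^(j-1) ≤ n (Bernoulli), hence j ≤ ⌈n/(p-1)⌉ and p^j ∣ c n; yet 0 < g < p^g.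
module Submission where

open import Defs
open import Data.Nat using (ℕ; _*_; _^_; _∸_; _≤_)
open import Data.Nat.Primality using (Prime)
open import Data.Nat.Divisibility using () renaming (_∣_ to _∣ℕ_)
open import Data.Integer using (+_)
open import Data.Integer.Divisibility using (_∣_)
open import Data.Rational using (↧ₙ_)
open import Data.Product using (_×_)
open import Relation.Nullary using (¬_)
open import Relation.Binary.PropositionalEquality using (_≢_)

open import Data.Bool.Base using (true; false; T; if_then_else_)
open import Data.Integer.Base as ℤ using (ℤ; 0ℤ; 1ℤ; -1ℤ)
import Data.Integer.Divisibility.Signed as ℤ
import Data.Integer.Properties as ℤ
open import Data.Integer.Tactic.RingSolver using (solve-∀)
open import Algebra.Properties.CommutativeSemigroup ℤ.*-commutativeSemigroup using (x∙yz≈y∙xz)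
open import Data.List.Base using (applyUpTo; map; upTo)
open import Data.List.Properties using (map-upTo)
open import Data.Nat.Base
  using ( zero; suc; _+_; _<_; _≤ᵇ_; z≤n; s≤s; z<s; s<s
        ; NonZero; ≢-nonZero; ≢-nonZero⁻¹; >-nonZero; >-nonZero⁻¹)
open import Data.Nat.Combinatorics using (_C_; nCn≡1; nC1≡n; nCk+nC[k+1]≡[n+1]C[k+1])
open import Data.Nat.Combinatorics.Specification using (k>n⇒nCk≡0)
open import Data.Nat.DivMod using (_/_; /-congˡ; /-monoˡ-≤; m/n≡1+[m∸n]/n; m*n/n≡m; m<n*o⇒m/o<n)
open import Data.Nat.Divisibility
  using (divides; ∣-trans; ∣-reflexive; ∣⇒≤; 1∣_; _∣0; *-pres-∣; *-cancelˡ-∣)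
open import Data.Nat.GCD using (gcd; gcd-greatest)
open import Data.Nat.GeneralisedArithmetic using (iterate; iterate-is-fold)
open import Data.Nat.Induction using (<-rec)
open import Data.Nat.Primality using (euclidsLemma; prime⇒nonTrivial)
open import Data.Nat.Properties
import Data.Nat.Tactic.RingSolver as ℕ
open import Data.Product using (_,_)
import Data.Rational.Base as ℚ
import Data.Rational.Properties as ℚ
open import Data.Sum.Base using (inj₁; inj₂)
open import Function.Base using (_∘_)
open import Relation.Binary.PropositionalEquality
  using (_≡_; refl; sym; trans; cong; cong₂; cong-app; subst; module ≡-Reasoning)
open import Relation.Nullary using (yes; no; contradiction)

∑ : ℕ → (ℕ → ℤ) → ℤ
∑ n f = sumℤ (applyUpTo f n)

syntax ∑ n (λ j → e) = ∑[ j < n ] e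

∑-cong : ∀ n {f g : ℕ → ℤ} → (∀ {j} → j < n → f j ≡ g j) → ∑ n f ≡ ∑ n g
∑-cong zero    f≡g = refl
∑-cong (suc n) f≡g = cong₂ ℤ._+_ (f≡g z<s) (∑-cong n (f≡g ∘ s<s))

∑-zero : ∀ n → ∑[ j < n ] 0ℤ ≡ 0ℤ
∑-zero zero    = refl
∑-zero (suc n) = trans (ℤ.+-identityˡ _) (∑-zero n)

∑-distrib-+ : ∀ n (f g : ℕ → ℤ) → ∑[ j < n ] (f j ℤ.+ g j) ≡ ∑ n f ℤ.+ ∑ n g
∑-distrib-+ zero    f g = refl
∑-distrib-+ (suc n) f g = begin
  f 0 ℤ.+ g 0 ℤ.+ ∑[ j < n ] (f (suc j) ℤ.+ g (suc j))
    ≡⟨ cong (ℤ._+_ (f 0 ℤ.+ g 0)) (∑-distrib-+ n (f ∘ suc) (g ∘ suc)) ⟩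
  f 0 ℤ.+ g 0 ℤ.+ (∑ n (f ∘ suc) ℤ.+ ∑ n (g ∘ suc))
    ≡⟨ interchange (f 0) (g 0) _ _ ⟩
  f 0 ℤ.+ ∑ n (f ∘ suc) ℤ.+ (g 0 ℤ.+ ∑ n (g ∘ suc)) ∎
  where
  open ≡-Reasoning
  interchange : ∀ a b c d → a ℤ.+ b ℤ.+ (c ℤ.+ d) ≡ a ℤ.+ c ℤ.+ (b ℤ.+ d)
  interchange = solve-∀

*-distribˡ-∑ : ∀ n k (f : ℕ → ℤ) → k ℤ.* ∑ n f ≡ ∑[ j < n ] (k ℤ.* f j)
*-distribˡ-∑ zero    k f = ℤ.*-zeroʳ k
*-distribˡ-∑ (suc n) k f =
  trans (ℤ.*-distribˡ-+ k (f 0) _) (cong (ℤ._+_ (k ℤ.* f 0)) (*-distribˡ-∑ n k (f ∘ suc)))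

∑-init-last : ∀ n (f : ℕ → ℤ) → ∑ (suc n) f ≡ ∑ n f ℤ.+ f n
∑-init-last zero    f = ℤ.+-comm (f 0) 0ℤ
∑-init-last (suc n) f =
  trans (cong (ℤ._+_ (f 0)) (∑-init-last n (f ∘ suc))) (sym (ℤ.+-assoc (f 0) _ _))

∑-comm : ∀ m n (f : ℕ → ℕ → ℤ) → ∑[ i < m ] ∑[ j < n ] f i j ≡ ∑[ j < n ] ∑[ i < m ] f i j
∑-comm zero    n f = sym (∑-zero n)
∑-comm (suc m) n f = trans (cong (ℤ._+_ (∑ n (f 0))) (∑-comm m n (f ∘ suc)))
                           (sym (∑-distrib-+ n (f 0) _))

∣-∑ : ∀ n {d} (f : ℕ → ℤ) → (∀ {j} → j < n → d ℤ.∣ f j) → d ℤ.∣ ∑ n f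
∣-∑ zero    f d∣f = ℤ.∣ᵤ⇒∣ (_ ∣0)
∣-∑ (suc n) f d∣f = ℤ.∣m∣n⇒∣m+n (d∣f z<s) (∣-∑ n (f ∘ suc) (d∣f ∘ s<s))

ceilDiv-+ : ∀ e n → ceilDiv (n + suc e) (suc e) ≡ suc (ceilDiv n (suc e))
ceilDiv-+ e n = begin
  (n + suc e + e) / suc e                   ≡⟨ /-congˡ (rearrange n e) ⟩
  (suc e + (n + e)) / suc e                 ≡⟨ m/n≡1+[m∸n]/n (m≤m+n (suc e) (n + e)) ⟩
  suc ((suc e + (n + e) ∸ suc e) / suc e)   ≡⟨ cong (λ m → suc (m / suc e)) (m+n∸m≡n (suc e) (n + e)) ⟩
  suc ((n + e) / suc e)                     ∎
  where
  open ≡-Reasoning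
  rearrange : ∀ n e → n + suc e + e ≡ suc e + (n + e)
  rearrange = ℕ.solve-∀

ceilDiv-monoˡ-≤ : ∀ e {m n} → m ≤ n → ceilDiv m (suc e) ≤ ceilDiv n (suc e)
ceilDiv-monoˡ-≤ e m≤n = /-monoˡ-≤ (suc e) (+-monoˡ-≤ e m≤n)

n≤q⇒ceilDiv≤1 : ∀ e {n} → n ≤ suc e → ceilDiv n (suc e) ≤ 1
n≤q⇒ceilDiv≤1 e {n} n≤1+e = ≤-pred (m<n*o⇒m/o<n (begin-strict
  n + e            ≤⟨ +-monoˡ-≤ e n≤1+e ⟩
  suc e + e        <⟨ +-monoʳ-< (suc e) (s≤s (m≤m+n e 0)) ⟩
  2 * suc e        ∎))
  where open ≤-Reasoning

i*q<n⇒i<ceilDiv : ∀ e {i n} → i * suc e < n → i < ceilDiv n (suc e)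
i*q<n⇒i<ceilDiv e {i} {n} i*q<n = begin
  suc i                       ≡⟨ m*n/n≡m (suc i) (suc e) ⟨
  suc i * suc e / suc e       ≤⟨ /-monoˡ-≤ (suc e) (≤-trans (≤-reflexive (rearrange i e))
                                                             (+-monoˡ-≤ e i*q<n)) ⟩
  (n + e) / suc e             ∎
  where
  open ≤-Reasoning
  rearrange : ∀ i e → suc i * suc e ≡ suc (i * suc e) + e
  rearrange = ℕ.solve-∀

m≤n⇒k^m∣k^n : ∀ k {m n} → m ≤ n → k ^ m ∣ℕ k ^ n
m≤n⇒k^m∣k^n k {m} {n} m≤n = divides (k ^ (n ∸ m)) (begin
  k ^ n                 ≡⟨ cong (k ^_) (m∸n+n≡m m≤n) ⟨
  k ^ (n ∸ m + m)       ≡⟨ ^-distribˡ-+-* k (n ∸ m) m ⟩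
  k ^ (n ∸ m) * k ^ m   ∎)
  where open ≡-Reasoning

1+m*n≤[1+n]^m : ∀ m n → suc (m * n) ≤ suc n ^ m
1+m*n≤[1+n]^m zero    n = ≤-refl
1+m*n≤[1+n]^m (suc m) n = begin
  suc (n + m * n)               ≡⟨ +-suc n (m * n) ⟨
  n + suc (m * n)               ≤⟨ +-mono-≤ (m≤m*n n (suc n ^ m)) (1+m*n≤[1+n]^m m n) ⟩
  n * suc n ^ m + suc n ^ m     ≡⟨ +-comm (n * suc n ^ m) (suc n ^ m) ⟩
  suc n * suc n ^ m             ∎
  where
  open ≤-Reasoning
  instance _ = m^n≢0 (suc n) m

[k+1]*[n+1]C[k+1]≡[n+1]*nCk : ∀ n k → suc k * (suc n C suc k) ≡ suc n * (n C k)
[k+1]*[n+1]C[k+1]≡[n+1]*nCk zero    zero    = refl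
[k+1]*[n+1]C[k+1]≡[n+1]*nCk zero    (suc k) = *-zeroʳ (suc (suc k))
[k+1]*[n+1]C[k+1]≡[n+1]*nCk (suc n) zero    =
  trans (*-identityˡ _) (trans (nC1≡n (suc (suc n))) (sym (*-identityʳ (suc (suc n)))))
[k+1]*[n+1]C[k+1]≡[n+1]*nCk (suc n) (suc k) = begin
  suc (suc k) * (suc (suc n) C suc (suc k))
    ≡⟨ cong (suc (suc k) *_) (nCk+nC[k+1]≡[n+1]C[k+1] (suc n) (suc k)) ⟨
  suc (suc k) * (X + Y)
    ≡⟨ expand k X Y ⟩
  X + (suc k * X + suc (suc k) * Y)
    ≡⟨ cong (_+_ X) (cong₂ _+_ ([k+1]*[n+1]C[k+1]≡[n+1]*nCk n k) ([k+1]*[n+1]C[k+1]≡[n+1]*nCk n (suc k))) ⟩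
  X + (suc n * (n C k) + suc n * (n C suc k))
    ≡⟨ cong (_+_ X) (*-distribˡ-+ (suc n) (n C k) (n C suc k)) ⟨
  X + suc n * (n C k + n C suc k)
    ≡⟨ cong (λ Z → X + suc n * Z) (nCk+nC[k+1]≡[n+1]C[k+1] n k) ⟩
  suc (suc n) * X
    ∎
  where
  open ≡-Reasoning
  X Y : ℕ
  X = suc n C suc k
  Y = suc n C suc (suc k)
  expand : ∀ k X Y → suc (suc k) * (X + Y) ≡ X + (suc k * X + suc (suc k) * Y)
  expand = ℕ.solve-∀

p∣pCk : ∀ {p k} → Prime p → 0 < k → k < p → p ∣ℕ p C k
p∣pCk {suc n} {suc k} pr _ k<p
  with euclidsLemma (suc k) (suc n C suc k) pr
         (divides (n C k) (trans ([k+1]*[n+1]C[k+1]≡[n+1]*nCk n k) (*-comm (suc n) (n C k))))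
... | inj₁ p∣k+1 = contradiction (∣⇒≤ p∣k+1) (<⇒≱ k<p)
... | inj₂ p∣pCk = p∣pCk

iterate-suc : ∀ {A : Set} (f : A → A) x n → iterate f x (suc n) ≡ f (iterate f x n)
iterate-suc f x n = trans (sym (iterate-is-fold x f (suc n))) (cong f (iterate-is-fold x f n))

iterate-+ : ∀ {A : Set} (f : A → A) x m n → iterate f x (m + n) ≡ iterate f (iterate f x m) n
iterate-+ f x zero    n = refl
iterate-+ f x (suc m) n = iterate-+ f (f x) m n

-- A sequence a stands for the formal power series ∑ₘ a m Xᵐ: shift is multiplication by X,
-- Δ multiplication by X - 1, and δ the constant 1.
Seq : Set
Seq = ℕ → ℤ

shift : Seq → Seq
shift a zero    = 0ℤ
shift a (suc m) = a m

Δ : Seq → Seq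
Δ a m = shift a m ℤ.- a m

δ : Seq
δ zero    = 1ℤ
δ (suc m) = 0ℤ

[X-1]^ : ℕ → Seq
[X-1]^ n = iterate Δ δ n

Δ+id≡shift : ∀ a m → Δ a m ℤ.+ a m ≡ shift a m
Δ+id≡shift a m = cancel (shift a m) (a m)
  where
  cancel : ∀ x y → x ℤ.- y ℤ.+ y ≡ x
  cancel = solve-∀

iterate-shift-< : ∀ k a {m} → m < k → iterate shift a k m ≡ 0ℤ
iterate-shift-< (suc k) a {zero}  _         = cong-app (iterate-suc shift a k) 0
iterate-shift-< (suc k) a {suc m} (s<s m<k) =
  trans (cong-app (iterate-suc shift a k) (suc m)) (iterate-shift-< k a m<k)

iterate-shift-+ : ∀ k a m → iterate shift a k (k + m) ≡ a m
iterate-shift-+ zero    a m = refl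
iterate-shift-+ (suc k) a m =
  trans (cong (iterate shift (shift a) k) (sym (+-suc k m))) (iterate-shift-+ k (shift a) (suc m))

iterate-shift-additive : ∀ k {a b c : Seq} → (∀ m → a m ℤ.+ b m ≡ c m) →
                         ∀ m → iterate shift a k m ℤ.+ iterate shift b k m ≡ iterate shift c k m
iterate-shift-additive zero    a+b≗c = a+b≗c
iterate-shift-additive (suc k) {a} {b} {c} a+b≗c = iterate-shift-additive k shift-additive
  where
  shift-additive : ∀ m → shift a m ℤ.+ shift b m ≡ shift c m
  shift-additive zero    = refl
  shift-additive (suc m) = a+b≗c m

-- ((X - 1) + 1)ᵖ = Xᵖ; the cut-off K ≥ p is free because the induction step needs both K and K + 1.
∑-binomial : ∀ p K → p ≤ K → ∀ a m →
             ∑[ j < suc K ] (+ (p C j) ℤ.* iterate Δ a j m) ≡ iterate shift a p m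
∑-binomial zero K _ a m =
  trans (cong₂ ℤ._+_ (ℤ.*-identityˡ (a m)) (∑-zero K)) (ℤ.+-identityʳ (a m))
∑-binomial (suc p) (suc K) (s≤s p≤K) a m = begin
  ∑[ j < suc (suc K) ] (+ (suc p C j) ℤ.* iterate Δ a j m)
    ≡⟨ cong (ℤ._+_ (1ℤ ℤ.* a m)) (∑-cong (suc K) (λ {j} _ → pascal j)) ⟩
  1ℤ ℤ.* a m ℤ.+ ∑[ j < suc K ] (lower j ℤ.+ upper j)
    ≡⟨ cong (ℤ._+_ (1ℤ ℤ.* a m)) (∑-distrib-+ (suc K) lower upper) ⟩
  1ℤ ℤ.* a m ℤ.+ (∑ (suc K) lower ℤ.+ ∑ (suc K) upper)
    ≡⟨ x+[y+z]≡y+[x+z] (1ℤ ℤ.* a m) (∑ (suc K) lower) (∑ (suc K) upper) ⟩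
  ∑ (suc K) lower ℤ.+ ∑[ j < suc (suc K) ] (+ (p C j) ℤ.* iterate Δ a j m)
    ≡⟨ cong₂ ℤ._+_ (∑-binomial p K p≤K (Δ a) m) (∑-binomial p (suc K) (m≤n⇒m≤1+n p≤K) a m) ⟩
  iterate shift (Δ a) p m ℤ.+ iterate shift a p m
    ≡⟨ iterate-shift-additive p (Δ+id≡shift a) m ⟩
  iterate shift (shift a) p m ∎
  where
  open ≡-Reasoning
  lower upper : ℕ → ℤ
  lower j = + (p C j) ℤ.* iterate Δ a (suc j) m
  upper j = + (p C suc j) ℤ.* iterate Δ a (suc j) m
  pascal : ∀ j → + (suc p C suc j) ℤ.* iterate Δ a (suc j) m ≡ lower j ℤ.+ upper j
  pascal j = begin
    + (suc p C suc j) ℤ.* iterate Δ a (suc j) m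
      ≡⟨ cong (λ k → + k ℤ.* iterate Δ a (suc j) m) (nCk+nC[k+1]≡[n+1]C[k+1] p j) ⟨
    + (p C j + p C suc j) ℤ.* iterate Δ a (suc j) m
      ≡⟨ cong (ℤ._* iterate Δ a (suc j) m) (ℤ.pos-+ (p C j) (p C suc j)) ⟩
    (+ (p C j) ℤ.+ + (p C suc j)) ℤ.* iterate Δ a (suc j) m
      ≡⟨ ℤ.*-distribʳ-+ (iterate Δ a (suc j) m) (+ (p C j)) (+ (p C suc j)) ⟩
    + (p C j) ℤ.* iterate Δ a (suc j) m ℤ.+ + (p C suc j) ℤ.* iterate Δ a (suc j) m ∎
  x+[y+z]≡y+[x+z] : ∀ x y z → x ℤ.+ (y ℤ.+ z) ≡ y ℤ.+ (x ℤ.+ z)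
  x+[y+z]≡y+[x+z] = solve-∀

∑-multiples : ℕ → ℕ → Seq → ℤ
∑-multiples p R a = ∑[ r < R ] a (p * r)

∑-multiples-shift : ∀ p .{{_ : NonZero p}} R a →
                    ∑-multiples p (suc R) (iterate shift a p) ≡ ∑-multiples p R a
∑-multiples-shift p R a = trans (cong₂ ℤ._+_ first rest) (ℤ.+-identityˡ (∑-multiples p R a))
  where
  first : iterate shift a p (p * 0) ≡ 0ℤ
  first = trans (cong (iterate shift a p) (*-zeroʳ p)) (iterate-shift-< p a (>-nonZero⁻¹ p))
  rest : ∑[ r < R ] iterate shift a p (p * suc r) ≡ ∑-multiples p R a
  rest = ∑-cong R (λ {r} _ → trans (cong (iterate shift a p) (*-suc p r)) (iterate-shift-+ p a (p * r)))

∑-multiples-stable : ∀ p .{{_ : NonZero p}} {n a} → (∀ {m} → n < m → a m ≡ 0ℤ) →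
                     ∀ {R} → n < R → ∑-multiples p R a ≡ ∑-multiples p (suc n) a
∑-multiples-stable p {n} {a} vanish {suc R} (s≤s n≤R) with m≤n⇒m<n∨m≡n n≤R
... | inj₂ refl = refl
... | inj₁ n<R  = begin
  ∑-multiples p (suc R) a               ≡⟨ ∑-init-last R (a ∘ (p *_)) ⟩
  ∑-multiples p R a ℤ.+ a (p * R)       ≡⟨ cong₂ ℤ._+_ (∑-multiples-stable p vanish n<R)
                                                         (vanish (<-≤-trans n<R (m≤n*m R p))) ⟩
  ∑-multiples p (suc n) a ℤ.+ 0ℤ        ≡⟨ ℤ.+-identityʳ _ ⟩
  ∑-multiples p (suc n) a               ∎
  where open ≡-Reasoning

[X-1]^-coeff : ∀ n m → [X-1]^ n m ≡ -1ℤ ℤ.^ (n ∸ m) ℤ.* + (n C m)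
[X-1]^-coeff zero    zero    = refl
[X-1]^-coeff zero    (suc m) = refl
[X-1]^-coeff (suc n) m       = trans (cong-app (iterate-suc Δ δ n) m) (Δ-coeff m)
  where
  open ≡-Reasoning
  sign : ℕ → ℤ
  sign k = -1ℤ ℤ.^ k
  sign-flip : ∀ m → ℤ.- (sign (n ∸ suc m) ℤ.* + (n C suc m)) ≡ sign (n ∸ m) ℤ.* + (n C suc m)
  sign-flip m with m <? n
  ... | yes m<n = trans (flip (sign (n ∸ suc m)) (+ (n C suc m)))
                        (cong (λ k → sign k ℤ.* + (n C suc m)) (sym (+-∸-assoc 1 m<n)))
    where
    flip : ∀ s c → ℤ.- (s ℤ.* c) ≡ -1ℤ ℤ.* s ℤ.* c
    flip = solve-∀
  ... | no m≮n rewrite k>n⇒nCk≡0 (s≤s (≮⇒≥ m≮n)) =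
    trans (cong ℤ.-_ (ℤ.*-zeroʳ (sign (n ∸ suc m)))) (sym (ℤ.*-zeroʳ (sign (n ∸ m))))
  Δ-coeff : ∀ m → Δ ([X-1]^ n) m ≡ sign (suc n ∸ m) ℤ.* + (suc n C m)
  Δ-coeff zero = trans (cong (ℤ._-_ 0ℤ) ([X-1]^-coeff n 0)) (negate (sign n))
    where
    negate : ∀ s → 0ℤ ℤ.- s ℤ.* 1ℤ ≡ -1ℤ ℤ.* s ℤ.* 1ℤ
    negate = solve-∀
  Δ-coeff (suc m) = begin
    [X-1]^ n m ℤ.- [X-1]^ n (suc m)
      ≡⟨ cong₂ ℤ._-_ ([X-1]^-coeff n m) ([X-1]^-coeff n (suc m)) ⟩
    sign (n ∸ m) ℤ.* + (n C m) ℤ.- sign (n ∸ suc m) ℤ.* + (n C suc m)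
      ≡⟨ cong (ℤ._+_ (sign (n ∸ m) ℤ.* + (n C m))) (sign-flip m) ⟩
    sign (n ∸ m) ℤ.* + (n C m) ℤ.+ sign (n ∸ m) ℤ.* + (n C suc m)
      ≡⟨ ℤ.*-distribˡ-+ (sign (n ∸ m)) (+ (n C m)) (+ (n C suc m)) ⟨
    sign (n ∸ m) ℤ.* (+ (n C m) ℤ.+ + (n C suc m))
      ≡⟨ cong (ℤ._*_ (sign (n ∸ m))) (ℤ.pos-+ (n C m) (n C suc m)) ⟨
    sign (n ∸ m) ℤ.* + (n C m + n C suc m)
      ≡⟨ cong (λ k → sign (n ∸ m) ℤ.* + k) (nCk+nC[k+1]≡[n+1]C[k+1] n m) ⟩
    sign (n ∸ m) ℤ.* + (suc n C suc m) ∎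

[X-1]^-vanishes : ∀ {n m} → n < m → [X-1]^ n m ≡ 0ℤ
[X-1]^-vanishes {n} {m} n<m = begin
  [X-1]^ n m                          ≡⟨ [X-1]^-coeff n m ⟩
  -1ℤ ℤ.^ (n ∸ m) ℤ.* + (n C m)       ≡⟨ cong (λ k → -1ℤ ℤ.^ (n ∸ m) ℤ.* + k) (k>n⇒nCk≡0 n<m) ⟩
  -1ℤ ℤ.^ (n ∸ m) ℤ.* 0ℤ              ≡⟨ ℤ.*-zeroʳ (-1ℤ ℤ.^ (n ∸ m)) ⟩
  0ℤ                                  ∎
  where open ≡-Reasoning

c/p : ℕ → ℕ → ℤ
c/p p n = ∑-multiples p (suc n) ([X-1]^ n)

c≡p*c/p : ∀ p n → c p n ≡ + p ℤ.* c/p p n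
c≡p*c/p p n = cong (ℤ._*_ (+ p)) (begin
  sumℤ (map (term ∘ (p *_)) (upTo (suc n)))   ≡⟨ cong sumℤ (map-upTo (term ∘ (p *_)) (suc n)) ⟩
  ∑[ r < suc n ] term (p * r)                 ≡⟨ ∑-cong (suc n) (λ {r} _ → term≡coeff (p * r)) ⟩
  c/p p n                                     ∎)
  where
  open ≡-Reasoning
  -- the summand of Defs.c, which cannot be named from here since it is local to c
  term : ℕ → ℤ
  term m = if m ≤ᵇ n then -1ℤ ℤ.^ (n ∸ m) ℤ.* + (n C m) else 0ℤ
  term≡coeff : ∀ m → term m ≡ [X-1]^ n m
  term≡coeff m = if-elim (m ≤ᵇ n) (λ _ → sym ([X-1]^-coeff n m))
                                   (λ m≰ᵇn → sym ([X-1]^-vanishes {n} {m} (≰⇒> (m≰ᵇn ∘ ≤⇒≤ᵇ))))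
    where
    if-elim : ∀ b {x y z : ℤ} → (T b → x ≡ z) → (¬ T b → y ≡ z) → (if b then x else y) ≡ z
    if-elim true  x≡z _   = x≡z _
    if-elim false _   y≡z = y≡z (λ ())

c/p-recurrence : ∀ p .{{_ : NonZero p}} N → ∑[ j < suc p ] (+ (p C j) ℤ.* c/p p (N + j)) ≡ c/p p N
c/p-recurrence p N = begin
  ∑[ j < suc p ] (+ (p C j) ℤ.* c/p p (N + j))
    ≡⟨ ∑-cong (suc p) (λ {j} j≤p → cong (ℤ._*_ (+ (p C j))) (widen j≤p)) ⟩
  ∑[ j < suc p ] (+ (p C j) ℤ.* ∑-multiples p R (iterate Δ a j))
    ≡⟨ ∑-cong (suc p) (λ {j} _ → *-distribˡ-∑ R (+ (p C j)) (λ r → iterate Δ a j (p * r))) ⟩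
  ∑[ j < suc p ] ∑[ r < R ] (+ (p C j) ℤ.* iterate Δ a j (p * r))
    ≡⟨ ∑-comm (suc p) R (λ j r → + (p C j) ℤ.* iterate Δ a j (p * r)) ⟩
  ∑[ r < R ] ∑[ j < suc p ] (+ (p C j) ℤ.* iterate Δ a j (p * r))
    ≡⟨ ∑-cong R (λ {r} _ → ∑-binomial p p ≤-refl a (p * r)) ⟩
  ∑-multiples p (suc (N + p)) (iterate shift a p)
    ≡⟨ ∑-multiples-shift p (N + p) a ⟩
  ∑-multiples p (N + p) a
    ≡⟨ ∑-multiples-stable p [X-1]^-vanishes (m<m+n N (>-nonZero⁻¹ p)) ⟩
  c/p p N ∎
  where
  open ≡-Reasoning
  R : ℕ
  R = suc (N + p)
  a : Seq
  a = [X-1]^ N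
  widen : ∀ {j} → j < suc p → c/p p (N + j) ≡ ∑-multiples p R (iterate Δ a j)
  widen {j} j≤p = begin
    c/p p (N + j)
      ≡⟨ ∑-multiples-stable p [X-1]^-vanishes (s≤s (+-monoʳ-≤ N (≤-pred j≤p))) ⟨
    ∑-multiples p R ([X-1]^ (N + j))
      ≡⟨ cong (∑-multiples p R) (iterate-+ Δ δ N j) ⟩
    ∑-multiples p R (iterate Δ a j) ∎

c-recurrence : ∀ p .{{_ : NonZero p}} N → ∑[ j < suc p ] (+ (p C j) ℤ.* c p (N + j)) ≡ c p N
c-recurrence p N = begin
  ∑[ j < suc p ] (+ (p C j) ℤ.* c p (N + j))
    ≡⟨ ∑-cong (suc p) (λ {j} _ → cong (ℤ._*_ (+ (p C j))) (c≡p*c/p p (N + j))) ⟩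
  ∑[ j < suc p ] (+ (p C j) ℤ.* (+ p ℤ.* c/p p (N + j)))
    ≡⟨ ∑-cong (suc p) (λ {j} _ → x∙yz≈y∙xz (+ (p C j)) (+ p) (c/p p (N + j))) ⟩
  ∑[ j < suc p ] (+ p ℤ.* (+ (p C j) ℤ.* c/p p (N + j)))
    ≡⟨ *-distribˡ-∑ (suc p) (+ p) (λ j → + (p C j) ℤ.* c/p p (N + j)) ⟨
  + p ℤ.* ∑[ j < suc p ] (+ (p C j) ℤ.* c/p p (N + j))
    ≡⟨ cong (ℤ._*_ (+ p)) (c/p-recurrence p N) ⟩
  + p ℤ.* c/p p N
    ≡⟨ c≡p*c/p p N ⟨
  c p N ∎
  where open ≡-Reasoning

binomial-recurrence⇒monic : ∀ q (x : Seq) N →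
  ∑[ j < suc (suc q) ] (+ (suc q C j) ℤ.* x (N + j)) ≡ x N →
  x (N + suc q) ℤ.+ ∑[ j < q ] (+ (suc q C suc j) ℤ.* x (N + suc j)) ≡ 0ℤ
binomial-recurrence⇒monic q x N recurrence = begin
  x (N + suc q) ℤ.+ middle
    ≡⟨ isolate (x N) middle (x (N + suc q)) ⟩
  1ℤ ℤ.* x N ℤ.+ (middle ℤ.+ 1ℤ ℤ.* x (N + suc q)) ℤ.- x N
    ≡⟨ cong (ℤ._- x N) expanded ⟩
  x N ℤ.- x N
    ≡⟨ ℤ.+-inverseʳ (x N) ⟩
  0ℤ ∎
  where
  open ≡-Reasoning
  middle : ℤ
  middle = ∑[ j < q ] (+ (suc q C suc j) ℤ.* x (N + suc j))
  expanded : 1ℤ ℤ.* x N ℤ.+ (middle ℤ.+ 1ℤ ℤ.* x (N + suc q)) ≡ x N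
  expanded = begin
    1ℤ ℤ.* x N ℤ.+ (middle ℤ.+ 1ℤ ℤ.* x (N + suc q))
      ≡⟨ cong₂ (λ i k → 1ℤ ℤ.* x i ℤ.+ (middle ℤ.+ + k ℤ.* x (N + suc q))) (+-identityʳ N) (nCn≡1 (suc q)) ⟨
    1ℤ ℤ.* x (N + 0) ℤ.+ (middle ℤ.+ + (suc q C suc q) ℤ.* x (N + suc q))
      ≡⟨ cong (ℤ._+_ (1ℤ ℤ.* x (N + 0))) (∑-init-last q (λ j → + (suc q C suc j) ℤ.* x (N + suc j))) ⟨
    ∑[ j < suc (suc q) ] (+ (suc q C j) ℤ.* x (N + j))
      ≡⟨ recurrence ⟩
    x N ∎
  isolate : ∀ u v w → w ℤ.+ v ≡ 1ℤ ℤ.* u ℤ.+ (v ℤ.+ 1ℤ ℤ.* w) ℤ.- u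
  isolate = solve-∀

monic-recurrence⇒^ceilDiv∣ : ∀ e d (x : Seq) (k : ℕ → ℤ) →
  (∀ {j} → j < suc e → + d ℤ.∣ k j) →
  (∀ N → x (N + suc (suc e)) ℤ.+ ∑[ j < suc e ] (k j ℤ.* x (N + suc j)) ≡ 0ℤ) →
  (∀ {n} → n ≤ suc e → + d ℤ.∣ x n) →
  ∀ n → + (d ^ ceilDiv n (suc e)) ℤ.∣ x n
monic-recurrence⇒^ceilDiv∣ e d x k d∣k recurrence initial = <-rec P divisible
  where
  q : ℕ
  q = suc e
  P : ℕ → Set
  P n = + (d ^ ceilDiv n q) ℤ.∣ x n

  initial-segment : ∀ {n} → n ≤ q → P n
  initial-segment n≤q = ℤ.∣-trans
    (ℤ.∣ᵤ⇒∣ (∣-trans (m≤n⇒k^m∣k^n d (n≤q⇒ceilDiv≤1 e n≤q)) (∣-reflexive (*-identityʳ d))))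
    (initial n≤q)

  next : ∀ N → (∀ {j} → j < q → P (N + suc j)) → P (N + suc q)
  next N ih = subst (λ i → + (d ^ i) ℤ.∣ x (N + suc q)) (sym ceil-step)
    (ℤ.∣m+n∣n⇒∣m (subst (+ (d ^ suc c₀) ℤ.∣_) (sym (recurrence N)) (ℤ.∣ᵤ⇒∣ (_ ∣0)))
                 (∣-∑ q (λ j → k j ℤ.* x (N + suc j)) term))
    where
    c₀ : ℕ
    c₀ = ceilDiv (suc N) q
    ceil-step : ceilDiv (N + suc q) q ≡ suc c₀
    ceil-step = trans (cong (λ n → ceilDiv n q) (+-suc N q)) (ceilDiv-+ e (suc N))
    term : ∀ {j} → j < q → + (d ^ suc c₀) ℤ.∣ k j ℤ.* x (N + suc j)
    term {j} j<q = subst (ℤ._∣ k j ℤ.* x (N + suc j)) (sym (ℤ.pos-* d (d ^ c₀)))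
      (ℤ.∣-trans (ℤ.*-monoˡ-∣ (+ (d ^ c₀)) (d∣k j<q))
                 (ℤ.*-monoʳ-∣ (k j) (ℤ.∣-trans (ℤ.∣ᵤ⇒∣ d^c₀∣d^⌈N+1+j⌉) (ih j<q))))
      where
      d^c₀∣d^⌈N+1+j⌉ : d ^ c₀ ∣ℕ d ^ ceilDiv (N + suc j) q
      d^c₀∣d^⌈N+1+j⌉ = m≤n⇒k^m∣k^n d
        (ceilDiv-monoˡ-≤ e (≤-trans (s≤s (m≤m+n N j)) (≤-reflexive (sym (+-suc N j)))))

  divisible : ∀ n → (∀ {m} → m < n → P m) → P n
  divisible n ih with n ≤? q
  ... | yes n≤q = initial-segment n≤q
  ... | no  n≰q = subst P (m∸n+n≡m q<n) (next (n ∸ suc q) (λ j<q → ih (below j<q)))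
    where
    q<n : q < n
    q<n = ≰⇒> n≰q
    below : ∀ {j} → j < q → n ∸ suc q + suc j < n
    below j<q = <-≤-trans (+-monoʳ-< (n ∸ suc q) (s<s j<q)) (≤-reflexive (m∸n+n≡m q<n))

p∤↧ₙ[x/m] : ∀ {p} → 1 < p → ∀ x m .{{_ : NonZero m}} →
            (∀ j → p ^ j ∣ℕ m → p ^ j ∣ℕ ℤ.∣ x ∣) → ¬ p ∣ℕ ↧ₙ (x ℚ./ m)
p∤↧ₙ[x/m] {p@(suc (suc e))} (s≤s (s≤s z≤n)) x m p^j∣m⇒p^j∣x p∣den = <⇒≱ g<p^g (∣⇒≤ (p^j∣g g))
  where
  den g : ℕ
  den = ↧ₙ (x ℚ./ m)
  g = gcd ℤ.∣ x ∣ m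
  den*g≡m : den * g ≡ m
  den*g≡m = ℤ.+-injective (trans (ℤ.pos-* den g) (ℚ.↧-/ x m))
  g≢0 : g ≢ 0
  g≢0 g≡0 = ≢-nonZero⁻¹ m (trans (sym den*g≡m) (trans (cong (den *_) g≡0) (*-zeroʳ den)))
  instance _ = ≢-nonZero g≢0
  p^j∣g : ∀ j → p ^ j ∣ℕ g
  p^j∣g zero    = 1∣ g
  p^j∣g (suc j) = gcd-greatest (p^j∣m⇒p^j∣x (suc j) p^[1+j]∣m) p^[1+j]∣m
    where
    p^[1+j]∣m : p ^ suc j ∣ℕ m
    p^[1+j]∣m = subst (p ^ suc j ∣ℕ_) den*g≡m (*-pres-∣ p∣den (p^j∣g j))
  g<p^g : g < p ^ g
  g<p^g = ≤-trans (s≤s (m≤m*n g (suc e))) (1+m*n≤[1+n]^m g (suc e))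

p^j∣p*n⇒j≤ceilDiv : ∀ e {n} j .{{_ : NonZero n}} →
                    suc (suc e) ^ j ∣ℕ suc (suc e) * n → j ≤ ceilDiv n (suc e)
p^j∣p*n⇒j≤ceilDiv e zero    _           = z≤n
p^j∣p*n⇒j≤ceilDiv e {n} (suc i) p^[1+i]∣p*n = i*q<n⇒i<ceilDiv e (begin-strict
  i * suc e          <⟨ n<1+n (i * suc e) ⟩
  suc (i * suc e)    ≤⟨ 1+m*n≤[1+n]^m i (suc e) ⟩
  suc (suc e) ^ i    ≤⟨ ∣⇒≤ (*-cancelˡ-∣ (suc (suc e)) p^[1+i]∣p*n) ⟩
  n                  ∎)
  where open ≤-Reasoning

lemma3p1 : (p : ℕ) → Prime p → (n : ℕ) → 1 ≤ n →
    ((+ (p ^ ceilDiv n (p ∸ 1))) ∣ c p n)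
    × ((h : p * n ≢ 0) → ¬ (p ∣ℕ (↧ₙ (divℚ (c p n) (p * n) h))))
lemma3p1 zero             pr _ _ with () ← prime⇒nonTrivial pr
lemma3p1 (suc zero)       pr _ _ with () ← prime⇒nonTrivial pr
lemma3p1 p@(suc (suc e)) pr n 1≤n = ℤ.∣⇒∣ᵤ p^⌈n/[p-1]⌉∣c , λ h →
  p∤↧ₙ[x/m] (s≤s (s≤s z≤n)) (c p n) (p * n) {{≢-nonZero h}}
    (λ j p^j∣pn → ∣-trans (m≤n⇒k^m∣k^n p (p^j∣p*n⇒j≤ceilDiv e j p^j∣pn)) (ℤ.∣⇒∣ᵤ p^⌈n/[p-1]⌉∣c))
  where
  instance _ = >-nonZero 1≤n
  p∣c : ∀ m → + p ℤ.∣ c p m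
  p∣c m = subst (+ p ℤ.∣_) (sym (c≡p*c/p p m)) (ℤ.∣m⇒∣m*n (c/p p m) ℤ.∣-refl)
  p^⌈n/[p-1]⌉∣c : + (p ^ ceilDiv n (suc e)) ℤ.∣ c p n
  p^⌈n/[p-1]⌉∣c = monic-recurrence⇒^ceilDiv∣ e p (c p) (λ j → + (p C suc j))
    (λ j<q → ℤ.∣ᵤ⇒∣ (p∣pCk pr z<s (s<s j<q)))
    (λ N → binomial-recurrence⇒monic (suc e) (c p) N (c-recurrence p N))
    (λ {m} _ → p∣c m)
    n
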